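{- The higher weight spectra of the Veronese code $C_2$ over $\mathbb{F}_2$ are \[ \begin{array}{llll} A_{2}^{(1)}=21, & A_{4}^{(1)}=35, & A_{6}^{(1)}=7, & A_{3}^{(2)}=35,\\ A_{4}^{(2)}=105, & A_{4}^{(3)}=35, & A_{5}^{(2)}=210, & A_{5}^{(3)}=210,\\ A_{5}^{(4)}=21, & A_{6}^{(2)}=210, & A_{6}^{(3)}=560, & A_{6}^{(4)}=175,\\ A_{6}^{(5)}=7, & A_{7}^{(2)}=91, & A_{7}^{(3)}=590, & A_{7}^{(4)}=455,\\ A_{7}^{(5)}=56, & A_{7}^{(6)}=1, & & \end{array} \] and all other $A_w^{(r)}$ are $0$.
   Context: For a prime power $q$, fix an ordering of the $q^2+q+1$ points of $\mathbb{P}^2$ over $\mathbb{F}_q$ and a coordinate representative $(x,y,z)$ of each. The Veronese code $C_q$ is the linear $[q^2+q+1,6]_q$ code with generator matrix whose columns are the vectors $(x^2,xy,xz,y^2,yz,z^2)$ for the chosen representatives; here $q=2$, giving a $[7,6]_2$ code. For a subcode $D$, its weight is the number of coordinates $i$ such that some codeword of $D$ has nonzero $i$-th entry. $A_w^{(r)}$ is the number of subcodes of dimension $r$ and weight $w$. -}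

module Defs where

open import Data.Bool using (Bool; true; false; _∧_; _∨_; _xor_)
open import Data.Nat using (ℕ; zero; suc)
open import Data.Fin using (Fin)
open import Data.List using (List; []; _∷_; length; filter; map; _++_)
open import Data.Bool.ListAction using (any)
open import Data.Bool using (T)
open import Relation.Nullary.Decidable using (T?)
open import Data.List.Relation.Unary.All using (All)
open import Data.List.Relation.Unary.Any using (Any)
open import Data.List.Relation.Unary.AllPairs using (AllPairs)
open import Data.Vec using (Vec; []; _∷_; lookup; zipWith; replicate; allFin)
open import Data.Vec as V using ()
open import Data.Product using (Σ; _×_; ∃)
open import Relation.Binary.PropositionalEquality using (_≡_)
open import Relation.Nullary using (¬_)

-- The field F_2 is modelled by Bool: addition = xor, multiplication = ∧.
F2 : Set
F2 = Bool

Word : ℕ → Set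
Word n = Vec F2 n

zeroW : (n : ℕ) → Word n
zeroW n = replicate n false

_⊕_ : {n : ℕ} → Word n → Word n → Word n
_⊕_ = zipWith _xor_

_·_ : {n : ℕ} → F2 → Word n → Word n
a · v = V.map (a ∧_) v

lincomb : {n r : ℕ} → Vec F2 r → Vec (Word n) r → Word n
lincomb {n} [] [] = zeroW n
lincomb (a ∷ as) (b ∷ bs) = (a · b) ⊕ lincomb as bs

dot : {n : ℕ} → Word n → Word n → F2
dot [] [] = false
dot (a ∷ as) (b ∷ bs) = (a ∧ b) xor dot as bs

-- The 7 points of P^2(F_2), each with its unique representative (x,y,z) ≠ 0,
-- in a fixed order.
points : Vec (Word 3) 7
points = (true  ∷ false ∷ false ∷ [])
       ∷ (false ∷ true  ∷ false ∷ [])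
       ∷ (false ∷ false ∷ true  ∷ [])
       ∷ (true  ∷ true  ∷ false ∷ [])
       ∷ (true  ∷ false ∷ true  ∷ [])
       ∷ (false ∷ true  ∷ true  ∷ [])
       ∷ (true  ∷ true  ∷ true  ∷ [])
       ∷ []

veroneseCol : Word 3 → Word 6
veroneseCol (x ∷ y ∷ z ∷ []) =
  (x ∧ x) ∷ (x ∧ y) ∷ (x ∧ z) ∷ (y ∧ y) ∷ (y ∧ z) ∷ (z ∧ z) ∷ []

genCols : Vec (Word 6) 7
genCols = V.map veroneseCol points

encode : Word 6 → Word 7
encode m = V.map (dot m) genCols

InC : Word 7 → Set
InC c = ∃ λ (m : Word 6) → encode m ≡ c

-- Subsets of F_2^7, given by (decidable) characteristic functions.
Subset7 : Set
Subset7 = Word 7 → Bool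

_≐_ : Subset7 → Subset7 → Set
D ≐ E = (x : Word 7) → D x ≡ E x

Independent : {n r : ℕ} → Vec (Word n) r → Set
Independent {n} {r} b = (λs : Vec F2 r) → lincomb λs b ≡ zeroW n → λs ≡ replicate r false

IsSubspaceDim : ℕ → Subset7 → Set
IsSubspaceDim r D = Σ (Vec (Word 7) r) λ b →
  Independent b ×
  ((x : Word 7) → D x ≡ true → ∃ λ (λs : Vec F2 r) → lincomb λs b ≡ x) ×
  ((λs : Vec F2 r) → D (lincomb λs b) ≡ true)

IsSubcode : ℕ → Subset7 → Set
IsSubcode r D = IsSubspaceDim r D × ((x : Word 7) → D x ≡ true → InC x)

allWords : (n : ℕ) → List (Word n)
allWords zero = [] ∷ []
allWords (suc n) = map (false ∷_) (allWords n) ++ map (true ∷_) (allWords n)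

inSupport : Subset7 → Fin 7 → Bool
inSupport D i = any (λ x → D x ∧ lookup x i) (allWords 7)

weight : Subset7 → ℕ
weight D = length (filter (λ i → T? (inSupport D i)) (Data.List.allFin 7))
  where import Data.List

-- "The set of subsets satisfying P (taken up to extensional equality) has
-- exactly n elements": there is a duplicate-free list of length n of
-- P-subsets containing (up to ≐) every P-subset.
HasCount : (Subset7 → Set) → ℕ → Set
HasCount P n = Σ (List Subset7) λ L →
  length L ≡ n ×
  All P L ×
  AllPairs (λ D E → ¬ (D ≐ E)) L ×
  ((D : Subset7) → P D → Any (D ≐_) L)

SpectrumIs : (r w n : ℕ) → Set
SpectrumIs r w n = HasCount (λ D → IsSubcode r D × weight D ≡ w) n

-- The claimed table of values (indexed r then w); 0 elsewhere.
table : ℕ → ℕ → ℕ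
table 1 2 = 21
table 1 4 = 35
table 1 6 = 7
table 2 3 = 35
table 2 4 = 105
table 2 5 = 210
table 2 6 = 210
table 2 7 = 91
table 3 4 = 35
table 3 5 = 210
table 3 6 = 560
table 3 7 = 590
table 4 5 = 21
table 4 6 = 175
table 4 7 = 455
table 5 6 = 7
table 5 7 = 56
table 6 7 = 1
table _ _ = 0

-- A subcode of dimension r is the span of r independent codewords, so the subcodes can be
-- listed dimension by dimension: every subcode of dimension r + 1 arises from one of
-- dimension r by adjoining a codeword outside it. A subspace of F₂ⁿ is stored as the binary
-- trie of its point set, and reading that trie as a numeral gives every subspace a
-- canonical code; sorting by code and removing repetitions keeps exactly one entry per
-- subcode. The weight of a span is the size of the union of the supports of its basis.
-- Evaluating this enumeration for C₂ and counting by weight reproduces the table.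
module Submission where

open import Defs
open import Data.Bool using (Bool; true; false; _∧_; _∨_; _xor_; T)
open import Data.Bool.Properties
  using ( xor-comm; xor-assoc; xor-same; ∧-distribʳ-xor; ∨-zeroʳ; ∨-identityʳ; T-≡; ⇔→≡
        ; xor-∧-commutativeRing)
open import Algebra.Bundles using (CommutativeRing)
open import Algebra.Properties.CommutativeSemigroup
  (CommutativeRing.+-commutativeSemigroup xor-∧-commutativeRing)
  using () renaming (interchange to xor-interchange)
open import Data.Empty using (⊥)
open import Data.Fin using (Fin; toℕ; fromℕ<)
open import Data.Fin.Properties using (all?; toℕ-fromℕ<)
open import Data.List using (List; []; _∷_; length; filter; map; concatMap; derun; allFin)
open import Data.List.Properties
  using (length-map; length-filter; length-tabulate; map-cong; filter-≐; filter-none)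
open import Data.List.Membership.Propositional using (_∈_; find; lose)
open import Data.List.Membership.Propositional.Properties
  using (∈-map⁺; ∈-map⁻; ∈-filter⁺; ∈-filter⁻; ∈-++⁺ˡ; ∈-++⁺ʳ)
open import Data.List.Relation.Unary.All as All using (All; []; _∷_)
import Data.List.Relation.Unary.All.Properties as All
open import Data.List.Relation.Unary.Any as Any using (Any; here; there)
import Data.List.Relation.Unary.Any.Properties as Any
open import Data.List.Relation.Unary.AllPairs using (AllPairs; []; _∷_)
import Data.List.Relation.Unary.AllPairs.Properties as AllPairs
open import Data.List.Relation.Unary.Linked using (Linked; linked?)
open import Data.List.Relation.Unary.Linked.Properties using (Linked⇒AllPairs)
open import Data.List.Relation.Binary.Permutation.Propositional using (↭-sym)
open import Data.List.Relation.Binary.Permutation.Propositional.Properties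
  using (All-resp-↭; Any-resp-↭)
import Data.List.Sort.MergeSort as MergeSort
open import Data.List.Sort.Base using (SortingAlgorithm)
open import Data.Bool.ListAction using (or)
open import Data.List.Relation.Unary.Any.Properties using (any⁺; any⁻)
open import Data.Nat
  using (ℕ; zero; suc; _+_; _*_; _≤_; _<_; _≤′_; ≤′-refl; ≤′-step; s≤s; z≤n; NonZero; >-nonZero⁻¹)
open import Data.Nat.Properties
  using ( _≟_; _<?_; ≤-decTotalOrder; <-trans; <-≤-trans; <-irrefl; ≤⇒≤′; m≤n⇒m<n∨m≡n
        ; +-suc; +-cancelˡ-≡; *-cancelʳ-≡; +-monoˡ-<; *-monoˡ-≤; m+n≡0⇒m≡0; m+n≡0⇒n≡0
        ; m*n≡0⇒m≡0; m*n≢0; ≤-<-connex; <-≤-connex; m≤n⇒∃[o]m+o≡n; m≤m+n)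
open import Data.Nat.DivMod using (_%_; m<n⇒m%n≡m; [m+kn]%n≡m%n)
open import Data.Product using (∃; _×_; _,_; proj₁; proj₂)
open import Data.Sum using (_⊎_; inj₁; inj₂; [_,_]′)
open import Data.Vec using (Vec; []; _∷_; lookup; replicate; zipWith)
import Data.Vec as Vec
import Data.Vec.Relation.Unary.All as VecAll
open import Data.Vec.Properties using (lookup-zipWith; lookup-replicate)
open import Function using (_∘_; id)
open import Function.Bundles using (mk⇔; Equivalence)
open import Relation.Binary.PropositionalEquality
  using (_≡_; refl; sym; trans; cong; cong₂; subst; _≗_; module ≡-Reasoning)
import Relation.Binary.Construct.On as On
open import Relation.Nullary using (¬_; Dec; yes; no; contradiction; does)
open import Relation.Nullary.Decidable using (T?; toWitness; isYes≗does; _×-dec_)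

open ≡-Reasoning

variable
  n r s : ℕ

⊕-comm : (x y : Word n) → x ⊕ y ≡ y ⊕ x
⊕-comm [] [] = refl
⊕-comm (a ∷ x) (b ∷ y) = cong₂ _∷_ (xor-comm a b) (⊕-comm x y)

⊕-assoc : (x y z : Word n) → (x ⊕ y) ⊕ z ≡ x ⊕ (y ⊕ z)
⊕-assoc [] [] [] = refl
⊕-assoc (a ∷ x) (b ∷ y) (c ∷ z) = cong₂ _∷_ (xor-assoc a b c) (⊕-assoc x y z)

⊕-identityˡ : (x : Word n) → zeroW n ⊕ x ≡ x
⊕-identityˡ [] = refl
⊕-identityˡ (a ∷ x) = cong (a ∷_) (⊕-identityˡ x)

⊕-identityʳ : (x : Word n) → x ⊕ zeroW n ≡ x
⊕-identityʳ x = trans (⊕-comm x _) (⊕-identityˡ x)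

⊕-self : (x : Word n) → x ⊕ x ≡ zeroW n
⊕-self [] = refl
⊕-self (a ∷ x) = cong₂ _∷_ (xor-same a) (⊕-self x)

⊕-cancelʳ : (x v : Word n) → (x ⊕ v) ⊕ v ≡ x
⊕-cancelʳ x v = begin
  (x ⊕ v) ⊕ v   ≡⟨ ⊕-assoc x v v ⟩
  x ⊕ (v ⊕ v)   ≡⟨ cong (x ⊕_) (⊕-self v) ⟩
  x ⊕ zeroW _   ≡⟨ ⊕-identityʳ x ⟩
  x             ∎

⊕-cancelˡ : (v x : Word n) → v ⊕ (x ⊕ v) ≡ x
⊕-cancelˡ v x = trans (⊕-comm v (x ⊕ v)) (⊕-cancelʳ x v)

⊕≡zero⇒≡ : (x y : Word n) → x ⊕ y ≡ zeroW n → y ≡ x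
⊕≡zero⇒≡ x y x⊕y≡0 = begin
  y               ≡⟨ ⊕-cancelˡ x y ⟨
  x ⊕ (y ⊕ x)     ≡⟨ cong (x ⊕_) (⊕-comm y x) ⟩
  x ⊕ (x ⊕ y)     ≡⟨ cong (x ⊕_) x⊕y≡0 ⟩
  x ⊕ zeroW _     ≡⟨ ⊕-identityʳ x ⟩
  x               ∎

⊕-interchange : (w x y z : Word n) → (w ⊕ x) ⊕ (y ⊕ z) ≡ (w ⊕ y) ⊕ (x ⊕ z)
⊕-interchange [] [] [] [] = refl
⊕-interchange (a ∷ w) (b ∷ x) (c ∷ y) (d ∷ z) =
  cong₂ _∷_ (xor-interchange a b c d) (⊕-interchange w x y z)

⊕-cancel-middle : (x y z : Word n) → (x ⊕ y) ⊕ (z ⊕ y) ≡ x ⊕ z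
⊕-cancel-middle x y z = begin
  (x ⊕ y) ⊕ (z ⊕ y)   ≡⟨ ⊕-interchange x y z y ⟩
  (x ⊕ z) ⊕ (y ⊕ y)   ≡⟨ cong ((x ⊕ z) ⊕_) (⊕-self y) ⟩
  (x ⊕ z) ⊕ zeroW _   ≡⟨ ⊕-identityʳ (x ⊕ z) ⟩
  x ⊕ z               ∎

·-distribʳ-xor : (a c : F2) (v : Word n) → (a · v) ⊕ (c · v) ≡ (a xor c) · v
·-distribʳ-xor a c [] = refl
·-distribʳ-xor a c (b ∷ v) = cong₂ _∷_ (sym (∧-distribʳ-xor b a c)) (·-distribʳ-xor a c v)

·-false : (v : Word n) → false · v ≡ zeroW n
·-false [] = refl
·-false (_ ∷ v) = cong (false ∷_) (·-false v)

·-true : (v : Word n) → true · v ≡ v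
·-true [] = refl
·-true (a ∷ v) = cong (a ∷_) (·-true v)

lincomb-∷false : (λs : Vec F2 r) (v : Word n) (b : Vec (Word n) r) →
  lincomb (false ∷ λs) (v ∷ b) ≡ lincomb λs b
lincomb-∷false λs v b = trans (cong (_⊕ lincomb λs b) (·-false v)) (⊕-identityˡ (lincomb λs b))

lincomb-∷true : (λs : Vec F2 r) (v : Word n) (b : Vec (Word n) r) →
  lincomb (true ∷ λs) (v ∷ b) ≡ v ⊕ lincomb λs b
lincomb-∷true λs v b = cong (_⊕ lincomb λs b) (·-true v)

lincomb-zero : (b : Vec (Word n) r) → lincomb (replicate r false) b ≡ zeroW n
lincomb-zero [] = refl
lincomb-zero (v ∷ b) = trans (lincomb-∷false (replicate _ false) v b) (lincomb-zero b)

lincomb-unit : (v : Word n) (b : Vec (Word n) r) → lincomb (true ∷ replicate r false) (v ∷ b) ≡ v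
lincomb-unit v b = begin
  lincomb (true ∷ replicate _ false) (v ∷ b)   ≡⟨ lincomb-∷true (replicate _ false) v b ⟩
  v ⊕ lincomb (replicate _ false) b            ≡⟨ cong (v ⊕_) (lincomb-zero b) ⟩
  v ⊕ zeroW _                                  ≡⟨ ⊕-identityʳ v ⟩
  v                                            ∎

lincomb-⊕ : (λs μs : Vec F2 r) (b : Vec (Word n) r) →
  lincomb λs b ⊕ lincomb μs b ≡ lincomb (zipWith _xor_ λs μs) b
lincomb-⊕ [] [] [] = ⊕-self _
lincomb-⊕ (a ∷ λs) (c ∷ μs) (v ∷ b) = begin
  ((a · v) ⊕ lincomb λs b) ⊕ ((c · v) ⊕ lincomb μs b)
    ≡⟨ ⊕-interchange (a · v) (lincomb λs b) (c · v) (lincomb μs b) ⟩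
  ((a · v) ⊕ (c · v)) ⊕ (lincomb λs b ⊕ lincomb μs b)
    ≡⟨ cong₂ _⊕_ (·-distribʳ-xor a c v) (lincomb-⊕ λs μs b) ⟩
  ((a xor c) · v) ⊕ lincomb (zipWith _xor_ λs μs) b
    ∎

lincomb-closed : (P : Word n → Set) → P (zeroW n) → (∀ x y → P x → P y → P (x ⊕ y)) →
  (λs : Vec F2 r) (b : Vec (Word n) r) → VecAll.All P b → P (lincomb λs b)
lincomb-closed P P0 P⊕ [] [] VecAll.[] = P0
lincomb-closed P P0 P⊕ (false ∷ λs) (v ∷ b) (_ VecAll.∷ Pb) =
  subst P (sym (lincomb-∷false λs v b)) (lincomb-closed P P0 P⊕ λs b Pb)
lincomb-closed P P0 P⊕ (true ∷ λs) (v ∷ b) (Pv VecAll.∷ Pb) =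
  subst P (sym (lincomb-∷true λs v b)) (P⊕ v _ Pv (lincomb-closed P P0 P⊕ λs b Pb))

dot-⊕ : (x y c : Word n) → dot (x ⊕ y) c ≡ dot x c xor dot y c
dot-⊕ [] [] [] = refl
dot-⊕ (a ∷ x) (b ∷ y) (e ∷ c) = begin
  ((a xor b) ∧ e) xor dot (x ⊕ y) c
    ≡⟨ cong₂ _xor_ (∧-distribʳ-xor e a b) (dot-⊕ x y c) ⟩
  ((a ∧ e) xor (b ∧ e)) xor (dot x c xor dot y c)
    ≡⟨ xor-interchange (a ∧ e) (b ∧ e) (dot x c) (dot y c) ⟩
  ((a ∧ e) xor dot x c) xor ((b ∧ e) xor dot y c)
    ∎

map-dot-⊕ : {k : ℕ} (x y : Word n) (cs : Vec (Word n) k) →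
  Vec.map (dot (x ⊕ y)) cs ≡ Vec.map (dot x) cs ⊕ Vec.map (dot y) cs
map-dot-⊕ x y [] = refl
map-dot-⊕ x y (c ∷ cs) = cong₂ _∷_ (dot-⊕ x y c) (map-dot-⊕ x y cs)

InC-⊕ : (x y : Word 7) → InC x → InC y → InC (x ⊕ y)
InC-⊕ _ _ (m , refl) (m′ , refl) = m ⊕ m′ , map-dot-⊕ m m′ genCols

InC-lincomb : (λs : Vec F2 r) (b : Vec (Word 7) r) → VecAll.All InC b → InC (lincomb λs b)
InC-lincomb = lincomb-closed InC (zeroW 6 , refl) InC-⊕

-- Finite subsets of F₂ⁿ as binary tries

data Trie : ℕ → Set where
  ∅    : Trie n
  ε    : Trie 0
  node : Trie n → Trie n → Trie (suc n)

member : Trie n → Word n → Bool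
member ∅ _ = false
member ε [] = true
member (node l r) (false ∷ x) = member l x
member (node l r) (true ∷ x) = member r x

_≈ᵗ_ : Trie n → Trie n → Set
A ≈ᵗ B = member A ≗ member B

_⊆ᵗ_ : Trie n → Trie n → Set
A ⊆ᵗ B = ∀ x → member A x ≡ true → member B x ≡ true

zeroTrie : (n : ℕ) → Trie n
zeroTrie zero = ε
zeroTrie (suc n) = node (zeroTrie n) ∅

_∪_ : Trie n → Trie n → Trie n
∅ ∪ B = B
ε ∪ _ = ε
node l r ∪ ∅ = node l r
node l r ∪ node l′ r′ = node (l ∪ l′) (r ∪ r′)

translate : Trie n → Word n → Trie n
translate ∅ _ = ∅
translate ε [] = ε
translate (node l r) (false ∷ v) = node (translate l v) (translate r v)
translate (node l r) (true ∷ v) = node (translate r v) (translate l v)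

extend : Trie n → Word n → Trie n
extend T v = T ∪ translate T v

member-zeroTrie : (n : ℕ) → member (zeroTrie n) (zeroW n) ≡ true
member-zeroTrie zero = refl
member-zeroTrie (suc n) = member-zeroTrie n

member-zeroTrie⁻ : (n : ℕ) (x : Word n) → member (zeroTrie n) x ≡ true → x ≡ zeroW n
member-zeroTrie⁻ zero [] _ = refl
member-zeroTrie⁻ (suc n) (false ∷ x) x∈ = cong (false ∷_) (member-zeroTrie⁻ n x x∈)
member-zeroTrie⁻ (suc n) (true ∷ x) ()

member-∪ : (A B : Trie n) (x : Word n) → member (A ∪ B) x ≡ member A x ∨ member B x
member-∪ ∅ B x = refl
member-∪ ε B [] = refl
member-∪ (node l r) ∅ x = sym (∨-identityʳ _)
member-∪ (node l r) (node l′ r′) (false ∷ x) = member-∪ l l′ x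
member-∪ (node l r) (node l′ r′) (true ∷ x) = member-∪ r r′ x

∪-∋ˡ : (A B : Trie n) (x : Word n) → member A x ≡ true → member (A ∪ B) x ≡ true
∪-∋ˡ A B x x∈A = trans (member-∪ A B x) (cong (_∨ member B x) x∈A)

∪-∋⁻ : (A B : Trie n) (x : Word n) → member (A ∪ B) x ≡ true →
  member A x ≡ true ⊎ member B x ≡ true
∪-∋⁻ A B x x∈ with member A x | member-∪ A B x
... | true  | _ = inj₁ refl
... | false | eq = inj₂ (trans (sym eq) x∈)

member-translate : (T : Trie n) (v x : Word n) → member (translate T v) x ≡ member T (x ⊕ v)
member-translate ∅ v x = refl
member-translate ε [] [] = refl
member-translate (node l r) (false ∷ v) (false ∷ x) = member-translate l v x
member-translate (node l r) (false ∷ v) (true ∷ x) = member-translate r v x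
member-translate (node l r) (true ∷ v) (false ∷ x) = member-translate r v x
member-translate (node l r) (true ∷ v) (true ∷ x) = member-translate l v x

member-extend : (T : Trie n) (v x : Word n) → member (extend T v) x ≡ member T x ∨ member T (x ⊕ v)
member-extend T v x = trans (member-∪ T (translate T v) x) (cong (member T x ∨_) (member-translate T v x))

extend-∋ˡ : (T : Trie n) (v x : Word n) → member T x ≡ true → member (extend T v) x ≡ true
extend-∋ˡ T v x x∈T = trans (member-extend T v x) (cong (_∨ member T (x ⊕ v)) x∈T)

extend-∋ʳ : (T : Trie n) (v x : Word n) → member T (x ⊕ v) ≡ true → member (extend T v) x ≡ true
extend-∋ʳ T v x x⊕v∈T =
  trans (member-extend T v x) (trans (cong (member T x ∨_) x⊕v∈T) (∨-zeroʳ _))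

extend-∋⁻ : (T : Trie n) (v x : Word n) → member (extend T v) x ≡ true →
  member T x ≡ true ⊎ member T (x ⊕ v) ≡ true
extend-∋⁻ T v x x∈ with member T x | member T (x ⊕ v) | member-extend T v x
... | true  | _ | _ = inj₁ refl
... | false | _ | e = inj₂ (trans (sym e) x∈)

extend-cong : (A B : Trie n) (v : Word n) → A ≈ᵗ B → extend A v ≈ᵗ extend B v
extend-cong A B v A≈B x = begin
  member (extend A v) x           ≡⟨ member-extend A v x ⟩
  member A x ∨ member A (x ⊕ v)   ≡⟨ cong₂ _∨_ (A≈B x) (A≈B (x ⊕ v)) ⟩
  member B x ∨ member B (x ⊕ v)   ≡⟨ member-extend B v x ⟨
  member (extend B v) x           ∎

-- Reading a trie as a numeral

codeBound : ℕ → ℕ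
codeBound zero = 2
codeBound (suc n) = codeBound n * codeBound n

codeBound-nonZero : (n : ℕ) → NonZero (codeBound n)
codeBound-nonZero zero = _
codeBound-nonZero (suc n) = m*n≢0 (codeBound n) (codeBound n) {{codeBound-nonZero n}} {{codeBound-nonZero n}}

code : Trie n → ℕ
code ∅ = 0
code ε = 1
code {suc n} (node l r) = code l + code r * codeBound n

code<codeBound : (T : Trie n) → code T < codeBound n
code<codeBound {n} ∅ = >-nonZero⁻¹ (codeBound n) {{codeBound-nonZero n}}
code<codeBound ε = s≤s (s≤s z≤n)
code<codeBound {suc n} (node l r) =
  <-≤-trans (+-monoˡ-< (code r * M) (code<codeBound l)) (*-monoˡ-≤ M (code<codeBound r))
  where M = codeBound n

digits-unique : (M : ℕ) .{{_ : NonZero M}} {a a′ b b′ : ℕ} → a < M → a′ < M →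
  a + b * M ≡ a′ + b′ * M → a ≡ a′ × b ≡ b′
digits-unique M {a} {a′} {b} {b′} a<M a′<M eq = a≡a′ , b≡b′
  where
  a≡a′ : a ≡ a′
  a≡a′ = begin
    a                   ≡⟨ m<n⇒m%n≡m a<M ⟨
    a % M               ≡⟨ [m+kn]%n≡m%n a b M ⟨
    (a + b * M) % M     ≡⟨ cong (_% M) eq ⟩
    (a′ + b′ * M) % M   ≡⟨ [m+kn]%n≡m%n a′ b′ M ⟩
    a′ % M              ≡⟨ m<n⇒m%n≡m a′<M ⟩
    a′                  ∎
  b≡b′ : b ≡ b′
  b≡b′ = *-cancelʳ-≡ b b′ M (+-cancelˡ-≡ a _ _ (trans eq (cong (_+ b′ * M) (sym a≡a′))))

code≡0⇒empty : (T : Trie n) → code T ≡ 0 → (x : Word n) → member T x ≡ false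
code≡0⇒empty ∅ _ x = refl
code≡0⇒empty (node l r) eq (false ∷ x) = code≡0⇒empty l (m+n≡0⇒m≡0 (code l) eq) x
code≡0⇒empty {suc n} (node l r) eq (true ∷ x) =
  code≡0⇒empty r (m*n≡0⇒m≡0 (code r) (codeBound n) {{codeBound-nonZero n}} (m+n≡0⇒n≡0 (code l) eq))
    x

empty⇒code≡0 : (T : Trie n) → ((x : Word n) → member T x ≡ false) → code T ≡ 0
empty⇒code≡0 ∅ _ = refl
empty⇒code≡0 ε empty with () ← empty []
empty⇒code≡0 (node l r) empty
  rewrite empty⇒code≡0 l (empty ∘ (false ∷_)) | empty⇒code≡0 r (empty ∘ (true ∷_)) = refl

code-node-injective : (l r l′ r′ : Trie n) → code (node l r) ≡ code (node l′ r′) →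
  code l ≡ code l′ × code r ≡ code r′
code-node-injective {n} l r l′ r′ =
  digits-unique (codeBound n) {{codeBound-nonZero n}} (code<codeBound l) (code<codeBound l′)

code-injective : (A B : Trie n) → code A ≡ code B → A ≈ᵗ B
code-injective ∅ B eq x = sym (code≡0⇒empty B (sym eq) x)
code-injective (node l r) ∅ eq x = code≡0⇒empty (node l r) eq x
code-injective ε ε _ [] = refl
code-injective (node l r) (node l′ r′) eq (false ∷ x) =
  code-injective l l′ (proj₁ (code-node-injective l r l′ r′ eq)) x
code-injective (node l r) (node l′ r′) eq (true ∷ x) =
  code-injective r r′ (proj₂ (code-node-injective l r l′ r′ eq)) x

code-cong : (A B : Trie n) → A ≈ᵗ B → code A ≡ code B
code-cong ∅ B A≈B = sym (empty⇒code≡0 B (sym ∘ A≈B))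
code-cong (node l r) ∅ A≈B = empty⇒code≡0 (node l r) A≈B
code-cong ε ε _ = refl
code-cong ε ∅ A≈B with () ← A≈B []
code-cong {suc n} (node l r) (node l′ r′) A≈B =
  cong₂ (λ a b → a + b * codeBound n)
    (code-cong l l′ (A≈B ∘ (false ∷_))) (code-cong r r′ (A≈B ∘ (true ∷_)))

spanTrie : Vec (Word n) r → Trie n
spanTrie {n} [] = zeroTrie n
spanTrie (v ∷ b) = extend (spanTrie b) v

spanTrie-lincomb : (b : Vec (Word n) r) (λs : Vec F2 r) → member (spanTrie b) (lincomb λs b) ≡ true
spanTrie-lincomb {n} [] [] = member-zeroTrie n
spanTrie-lincomb (v ∷ b) (false ∷ λs) rewrite lincomb-∷false λs v b =
  extend-∋ˡ (spanTrie b) v (lincomb λs b) (spanTrie-lincomb b λs)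
spanTrie-lincomb (v ∷ b) (true ∷ λs) rewrite lincomb-∷true λs v b =
  extend-∋ʳ (spanTrie b) v (v ⊕ lincomb λs b)
    (subst (λ y → member (spanTrie b) y ≡ true) (sym v⊕y⊕v≡y)
      (spanTrie-lincomb b λs))
  where
  v⊕y⊕v≡y : (v ⊕ lincomb λs b) ⊕ v ≡ lincomb λs b
  v⊕y⊕v≡y = trans (cong (_⊕ v) (⊕-comm v _)) (⊕-cancelʳ (lincomb λs b) v)

spanTrie-lincomb⁻ : (b : Vec (Word n) r) (x : Word n) → member (spanTrie b) x ≡ true →
  ∃ λ (λs : Vec F2 r) → lincomb λs b ≡ x
spanTrie-lincomb⁻ {n} [] x x∈ = [] , sym (member-zeroTrie⁻ n x x∈)
spanTrie-lincomb⁻ (v ∷ b) x x∈ with extend-∋⁻ (spanTrie b) v x x∈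
... | inj₁ x∈span with λs , refl ← spanTrie-lincomb⁻ b x x∈span =
  false ∷ λs , lincomb-∷false λs v b
... | inj₂ x⊕v∈span with λs , eq ← spanTrie-lincomb⁻ b (x ⊕ v) x⊕v∈span =
  true ∷ λs , trans (lincomb-∷true λs v b) (trans (cong (v ⊕_) eq) (⊕-cancelˡ v x))

⊕-Closed : Trie n → Set
⊕-Closed T = ∀ x y → member T x ≡ true → member T y ≡ true → member T (x ⊕ y) ≡ true

spanTrie-closed : (b : Vec (Word n) r) → ⊕-Closed (spanTrie b)
spanTrie-closed b x y x∈ y∈
  with λs , refl ← spanTrie-lincomb⁻ b x x∈ | μs , refl ← spanTrie-lincomb⁻ b y y∈ =
  subst (λ z → member (spanTrie b) z ≡ true) (sym (lincomb-⊕ λs μs b))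
    (spanTrie-lincomb b (zipWith _xor_ λs μs))

-- v ⊕ u ∈ T, so by closure x ⊕ u ∈ T exactly when x ⊕ v ∈ T.
extend-by-new-member : (T : Trie n) → ⊕-Closed T → (u v : Word n) →
  member (extend T u) v ≡ true → member T v ≡ false → extend T u ≈ᵗ extend T v
extend-by-new-member T closed u v v∈ v∉ x = begin
  member (extend T u) x           ≡⟨ member-extend T u x ⟩
  member T x ∨ member T (x ⊕ u)   ≡⟨ cong (member T x ∨_) (⇔→≡ (mk⇔ (shift u v v⊕u∈) (shift v u u⊕v∈))) ⟩
  member T x ∨ member T (x ⊕ v)   ≡⟨ member-extend T v x ⟨
  member (extend T v) x           ∎
  where
  v⊕u∈ : member T (v ⊕ u) ≡ true
  v⊕u∈ with extend-∋⁻ T u v v∈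
  ... | inj₁ v∈T with () ← trans (sym v∈T) v∉
  ... | inj₂ v⊕u∈T = v⊕u∈T
  u⊕v∈ : member T (u ⊕ v) ≡ true
  u⊕v∈ = subst (λ z → member T z ≡ true) (⊕-comm v u) v⊕u∈
  shift : (a c : Word _) → member T (c ⊕ a) ≡ true →
    member T (x ⊕ a) ≡ true → member T (x ⊕ c) ≡ true
  shift a c c⊕a∈ x⊕a∈ =
    subst (λ z → member T z ≡ true) (⊕-cancel-middle x a c) (closed _ _ x⊕a∈ c⊕a∈)

independent-[] : Independent {n} []
independent-[] [] _ = refl

independent-∷ : (v : Word n) (b : Vec (Word n) r) → Independent b →
  member (spanTrie b) v ≡ false → Independent (v ∷ b)
independent-∷ v b indep v∉ (false ∷ μs) eq =
  cong (false ∷_) (indep μs (trans (sym (lincomb-∷false μs v b)) eq))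
independent-∷ v b indep v∉ (true ∷ μs) eq with () ← trans (sym (spanTrie-lincomb b μs))
  (trans (cong (member (spanTrie b)) (⊕≡zero⇒≡ v _ (trans (sym (lincomb-∷true μs v b)) eq))) v∉)

independent-tail : (v : Word n) (b : Vec (Word n) r) → Independent (v ∷ b) → Independent b
independent-tail v b indep μs eq = cong Vec.tail (indep (false ∷ μs) (trans (lincomb-∷false μs v b) eq))

independent-head∉span : (v : Word n) (b : Vec (Word n) r) → Independent (v ∷ b) →
  member (spanTrie b) v ≡ false
independent-head∉span v b indep with member (spanTrie b) v in v∈
... | false = refl
... | true with μs , eq ← spanTrie-lincomb⁻ b v v∈ =
  contradiction (cong Vec.head (indep (true ∷ μs) v⊕v≡0)) λ ()
  where
  v⊕v≡0 : lincomb (true ∷ μs) (v ∷ b) ≡ zeroW _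
  v⊕v≡0 = trans (lincomb-∷true μs v b) (trans (cong (v ⊕_) eq) (⊕-self v))

-- Supports and weights

allWords-complete : (n : ℕ) (x : Word n) → x ∈ allWords n
allWords-complete zero [] = here refl
allWords-complete (suc n) (false ∷ x) = ∈-++⁺ˡ (∈-map⁺ (false ∷_) (allWords-complete n x))
allWords-complete (suc n) (true ∷ x) =
  ∈-++⁺ʳ (map (false ∷_) (allWords n)) (∈-map⁺ (true ∷_) (allWords-complete n x))

basisSupport : Vec (Word n) r → Fin n → Bool
basisSupport [] i = false
basisSupport (v ∷ b) i = lookup v i ∨ basisSupport b i

supportSize : Vec (Word n) r → ℕ
supportSize {n} b = length (filter (λ i → T? (basisSupport b i)) (allFin n))

lincomb-support : (λs : Vec F2 r) (b : Vec (Word n) r) (i : Fin n) →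
  lookup (lincomb λs b) i ≡ true → basisSupport b i ≡ true
lincomb-support [] [] i eq with () ← trans (sym (lookup-replicate i false)) eq
lincomb-support (false ∷ λs) (v ∷ b) i eq rewrite lincomb-∷false λs v b =
  trans (cong (lookup v i ∨_) (lincomb-support λs b i eq)) (∨-zeroʳ _)
lincomb-support (true ∷ λs) (v ∷ b) i eq rewrite lincomb-∷true λs v b
  with lookup v i | lookup-zipWith _xor_ i v (lincomb λs b)
... | true  | _ = refl
... | false | vᵢ⊕yᵢ = lincomb-support λs b i (trans (sym vᵢ⊕yᵢ) eq)

basisSupport-witness : (b : Vec (Word n) r) (i : Fin n) → basisSupport b i ≡ true →
  ∃ λ x → member (spanTrie b) x ≡ true × lookup x i ≡ true
basisSupport-witness (v ∷ b) i supp with lookup v i in vᵢ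
... | true = v , subst (λ x → member (spanTrie (v ∷ b)) x ≡ true) (lincomb-unit v b)
                   (spanTrie-lincomb (v ∷ b) (true ∷ replicate _ false)) , vᵢ
... | false with x , x∈ , xᵢ ← basisSupport-witness b i supp =
  x , extend-∋ˡ (spanTrie b) v x x∈ , xᵢ

∧≡true : {a c : Bool} → a ∧ c ≡ true → a ≡ true × c ≡ true
∧≡true {true} {true} _ = refl , refl

inSupport-spanTrie : (b : Vec (Word 7) r) (i : Fin 7) →
  inSupport (member (spanTrie b)) i ≡ basisSupport b i
inSupport-spanTrie b i = ⇔→≡ (mk⇔ to from)
  where
  p : Word 7 → Bool
  p x = member (spanTrie b) x ∧ lookup x i
  to : inSupport (member (spanTrie b)) i ≡ true → basisSupport b i ≡ true
  to supp =
    let x , _ , px = find (any⁻ p (allWords 7) (Equivalence.from T-≡ supp))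
        x∈ , xᵢ = ∧≡true (Equivalence.to T-≡ px)
        λs , λs·b≡x = spanTrie-lincomb⁻ b x x∈
    in lincomb-support λs b i (subst (λ y → lookup y i ≡ true) (sym λs·b≡x) xᵢ)
  from : basisSupport b i ≡ true → inSupport (member (spanTrie b)) i ≡ true
  from supp with x , x∈ , xᵢ ← basisSupport-witness b i supp =
    Equivalence.to T-≡
      (any⁺ p (lose (allWords-complete 7 x) (Equivalence.from T-≡ (cong₂ _∧_ x∈ xᵢ))))

filter-T-cong : {A : Set} {f g : A → Bool} → f ≗ g → (xs : List A) →
  filter (λ x → T? (f x)) xs ≡ filter (λ x → T? (g x)) xs
filter-T-cong {f = f} {g} f≗g =
  filter-≐ (λ x → T? (f x)) (λ x → T? (g x))
    ((λ {x} → subst T (f≗g x)) , (λ {x} → subst T (sym (f≗g x))))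

weight-cong : (D D′ : Subset7) → D ≐ D′ → weight D ≡ weight D′
weight-cong D D′ D≐D′ = cong length (filter-T-cong inSupport≗ (allFin 7))
  where
  inSupport≗ : inSupport D ≗ inSupport D′
  inSupport≗ i = cong or (map-cong (λ x → cong (_∧ lookup x i) (D≐D′ x)) (allWords 7))

weight-spanTrie : (b : Vec (Word 7) r) → weight (member (spanTrie b)) ≡ supportSize b
weight-spanTrie b = cong length (filter-T-cong (inSupport-spanTrie b) (allFin 7))

supportSize≤ : (b : Vec (Word n) r) → supportSize b ≤ n
supportSize≤ {n} b = subst (supportSize b ≤_) (length-tabulate id)
  (length-filter (λ i → T? (basisSupport b i)) (allFin n))

-- Enumerating the subspaces spanned by vectors from a list

Any-mapWith : {A : Set} {P Q R : A → Set} {xs : List A} →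
  (∀ {x} → P x → Q x → R x) → All P xs → Any Q xs → Any R xs
Any-mapWith f (px ∷ _) (here qx) = here (f px qx)
Any-mapWith f (_ ∷ pxs) (there qxs) = there (Any-mapWith f pxs qxs)

AllPairs-mapWith : {A : Set} {P : A → Set} {R S : A → A → Set} {xs : List A} →
  (∀ {x y} → P x → P y → R x y → S x y) → All P xs → AllPairs R xs → AllPairs S xs
AllPairs-mapWith f [] [] = []
AllPairs-mapWith f (px ∷ pxs) (rxs ∷ rxss) =
  All.zipWith (λ (py , rxy) → f px py rxy) (pxs , rxs) ∷ AllPairs-mapWith f pxs rxss

module Enumeration {n : ℕ} (cs : List (Word n)) where

  -- key caches code trie, so that sorting does not recompute it.
  record Entry (r : ℕ) : Set where
    constructor entry
    field
      basis : Vec (Word n) r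
      trie  : Trie n
      key   : ℕ
  open Entry public

  mkEntry : Vec (Word n) r → Trie n → Entry r
  mkEntry b T = entry b T (code T)

  WellFormed : Entry r → Set
  WellFormed e =
    trie e ≡ spanTrie (basis e) × key e ≡ code (trie e) ×
    Independent (basis e) × VecAll.All (_∈ cs) (basis e)

  -- covered holds T together with the extensions emitted so far, so that no subspace
  -- T + ⟨v⟩ is emitted twice.
  extensions : Vec (Word n) r → Trie n → Trie n → List (Word n) → List (Entry (suc r))
  extensions b T covered [] = []
  extensions b T covered (v ∷ vs) with member covered v | extend T v
  ... | true  | _ = extensions b T covered vs
  ... | false | S = mkEntry (v ∷ b) S ∷ extensions b T (covered ∪ S) vs

  extensions-wellFormed : (b : Vec (Word n) r) → Independent b → VecAll.All (_∈ cs) b →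
    (covered : Trie n) → spanTrie b ⊆ᵗ covered → (vs : List (Word n)) → All (_∈ cs) vs →
    All WellFormed (extensions b (spanTrie b) covered vs)
  extensions-wellFormed b indep b⊆cs covered span⊆ [] [] = []
  extensions-wellFormed b indep b⊆cs covered span⊆ (v ∷ vs) (v∈cs ∷ vs⊆cs)
    with member covered v in v∈? | extend (spanTrie b) v in S≡
  ... | true  | _ = extensions-wellFormed b indep b⊆cs covered span⊆ vs vs⊆cs
  ... | false | S =
    (sym S≡ , refl , independent-∷ v b indep v∉span , v∈cs VecAll.∷ b⊆cs) ∷
    extensions-wellFormed b indep b⊆cs (covered ∪ S) (λ x x∈ → ∪-∋ˡ covered S x (span⊆ x x∈))
      vs vs⊆cs
    where
    v∉span : member (spanTrie b) v ≡ false
    v∉span with member (spanTrie b) v in v∈span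
    ... | false = refl
    ... | true with () ← trans (sym (span⊆ v v∈span)) v∈?

  extensions-complete : (b : Vec (Word n) r) (T : Trie n) → ⊕-Closed T → (Seen : Word n → Set) →
    (covered : Trie n) → (∀ x → member covered x ≡ true → member T x ≡ true ⊎ Seen x) →
    (vs : List (Word n)) (v : Word n) → v ∈ vs → member T v ≡ false →
    Seen v ⊎ Any (λ e → trie e ≈ᵗ extend T v) (extensions b T covered vs)
  extensions-complete b T closed Seen covered covered⊆ (u ∷ vs) v v∈ v∉T
    with member covered u in u∈? | extend T u in S≡
  extensions-complete b T closed Seen covered covered⊆ (u ∷ vs) v (here refl) v∉T | true | _
    with covered⊆ u u∈?
  ... | inj₁ u∈T with () ← trans (sym u∈T) v∉T
  ... | inj₂ seen = inj₁ seen
  extensions-complete b T closed Seen covered covered⊆ (u ∷ vs) v (here refl) v∉T | false | S =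
    inj₂ (here λ x → cong (λ S → member S x) (sym S≡))
  extensions-complete b T closed Seen covered covered⊆ (u ∷ vs) v (there v∈) v∉T | true | _ =
    extensions-complete b T closed Seen covered covered⊆ vs v v∈ v∉T
  extensions-complete b T closed Seen covered covered⊆ (u ∷ vs) v (there v∈) v∉T | false | S
    with extensions-complete b T closed (λ x → Seen x ⊎ member S x ≡ true) (covered ∪ S) covered∪S⊆
           vs v v∈ v∉T
    where
    covered∪S⊆ : ∀ x → member (covered ∪ S) x ≡ true →
      member T x ≡ true ⊎ (Seen x ⊎ member S x ≡ true)
    covered∪S⊆ x x∈ with ∪-∋⁻ covered S x x∈
    ... | inj₂ x∈S = inj₂ (inj₂ x∈S)
    ... | inj₁ x∈covered with covered⊆ x x∈covered
    ...   | inj₁ x∈T = inj₁ x∈T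
    ...   | inj₂ seen = inj₂ (inj₁ seen)
  ... | inj₁ (inj₁ seen) = inj₁ seen
  ... | inj₁ (inj₂ v∈S) = inj₂ (here λ x → trans (cong (λ S → member S x) (sym S≡))
          (extend-by-new-member T closed u v (subst (λ S → member S v ≡ true) (sym S≡) v∈S) v∉T x))
  ... | inj₂ found = inj₂ (there found)

  successors : Entry r → List (Entry (suc r))
  successors (entry b T _) = extensions b T T cs

  successors-wellFormed : (e : Entry r) → WellFormed e → All WellFormed (successors e)
  successors-wellFormed (entry b _ _) (refl , _ , indep , b⊆cs) =
    extensions-wellFormed b indep b⊆cs (spanTrie b) (λ _ → id) cs (All.tabulate id)

  successors-complete : (e : Entry r) → WellFormed e → (v : Word n) → v ∈ cs →
    member (trie e) v ≡ false → Any (λ e′ → trie e′ ≈ᵗ extend (trie e) v) (successors e)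
  successors-complete (entry b _ _) (refl , _) v v∈cs v∉
    with extensions-complete b (spanTrie b) (spanTrie-closed b) (λ _ → ⊥) (spanTrie b) (λ _ → inj₁)
           cs v v∈cs v∉
  ... | inj₂ found = found

  module ByKey (r : ℕ) = MergeSort (On.decTotalOrder ≤-decTotalOrder (key {r}))

  dedupByKey : List (Entry r) → List (Entry r)
  dedupByKey {r} es = derun (λ e e′ → key e ≟ key e′) (ByKey.sort r es)

  dedupByKey-wellFormed : {es : List (Entry r)} → All WellFormed es → All WellFormed (dedupByKey es)
  dedupByKey-wellFormed {r} {es} wf =
    All.derun⁺ _ (All-resp-↭ (↭-sym (SortingAlgorithm.sort-↭ (ByKey.mergeSort r) es)) wf)

  dedupByKey-complete : {es : List (Entry r)} (T : Trie n) → All WellFormed es →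
    Any (λ e → trie e ≈ᵗ T) es → Any (λ e → trie e ≈ᵗ T) (dedupByKey es)
  dedupByKey-complete {r} {es} T wf found =
    Any-mapWith located (dedupByKey-wellFormed wf)
      (Any.derun⁺ _ (λ k≡k′ k≡c → trans (sym k≡k′) k≡c)
        (Any-resp-↭ (↭-sym (SortingAlgorithm.sort-↭ (ByKey.mergeSort r) es))
          (Any-mapWith keyed wf found)))
    where
    keyed : {e : Entry r} → WellFormed e → trie e ≈ᵗ T → key e ≡ code T
    keyed {e} (_ , key≡ , _) e≈T = trans key≡ (code-cong (trie e) T e≈T)
    located : {e : Entry r} → WellFormed e → key e ≡ code T → trie e ≈ᵗ T
    located {e} (_ , key≡ , _) k≡ = code-injective (trie e) T (trans (sym key≡) k≡)

  next : List (Entry r) → List (Entry (suc r))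
  next es = dedupByKey (concatMap successors es)

  subspaces : (r : ℕ) → List (Entry r)
  subspaces zero = mkEntry [] (zeroTrie n) ∷ []
  subspaces (suc r) = next (subspaces r)

  successors-all-wellFormed : {es : List (Entry r)} → All WellFormed es →
    All WellFormed (concatMap successors es)
  successors-all-wellFormed wf = All.concat⁺ (All.map⁺ (All.map (λ {e} → successors-wellFormed e) wf))

  subspaces-wellFormed : (r : ℕ) → All WellFormed (subspaces r)
  subspaces-wellFormed zero = (refl , refl , independent-[] , VecAll.[]) ∷ []
  subspaces-wellFormed (suc r) = dedupByKey-wellFormed (successors-all-wellFormed (subspaces-wellFormed r))

  subspaces-complete : (b : Vec (Word n) r) → Independent b → VecAll.All (_∈ cs) b →
    Any (λ e → trie e ≈ᵗ spanTrie b) (subspaces r)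
  subspaces-complete [] _ _ = here λ _ → refl
  subspaces-complete {suc r} (v ∷ b) indep (v∈cs VecAll.∷ b⊆cs) =
    dedupByKey-complete (spanTrie (v ∷ b)) (successors-all-wellFormed wf)
      (Any.concat⁺ (Any.map⁺ (Any-mapWith extend-found wf
        (subspaces-complete b (independent-tail v b indep) b⊆cs))))
    where
    wf = subspaces-wellFormed r
    extend-found : {e : Entry r} → WellFormed e → trie e ≈ᵗ spanTrie b →
      Any (λ e′ → trie e′ ≈ᵗ spanTrie (v ∷ b)) (successors e)
    extend-found {e} wfe e≈b =
      Any.map (λ e′≈ x → trans (e′≈ x) (extend-cong (trie e) (spanTrie b) v e≈b x))
        (successors-complete e wfe v v∈cs (trans (e≈b v) (independent-head∉span v b indep)))

codewords : List (Word 7)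
codewords = map encode (allWords 6)

∈codewords⇒InC : {x : Word 7} → x ∈ codewords → InC x
∈codewords⇒InC x∈ = let m , _ , x≡ = ∈-map⁻ encode {xs = allWords 6} x∈ in m , sym x≡

InC⇒∈codewords : {x : Word 7} → InC x → x ∈ codewords
InC⇒∈codewords (m , refl) = ∈-map⁺ encode (allWords-complete 6 m)

open Enumeration codewords

entry-subcode : (e : Entry r) → WellFormed e → IsSubcode r (member (trie e))
entry-subcode (entry b _ _) (refl , _ , indep , b⊆cs) =
  (b , indep , spanTrie-lincomb⁻ b , spanTrie-lincomb b) , inC
  where
  inC : (x : Word 7) → member (spanTrie b) x ≡ true → InC x
  inC x x∈ with λs , refl ← spanTrie-lincomb⁻ b x x∈ =
    InC-lincomb λs b (VecAll.map ∈codewords⇒InC b⊆cs)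

entry-weight : (e : Entry r) → WellFormed e → weight (member (trie e)) ≡ supportSize (basis e)
entry-weight (entry b _ _) (refl , _) = weight-spanTrie b

basis-⊆ : (D : Subset7) (b : Vec (Word 7) r) → ((λs : Vec F2 r) → D (lincomb λs b) ≡ true) →
  VecAll.All (λ v → D v ≡ true) b
basis-⊆ D [] _ = VecAll.[]
basis-⊆ D (v ∷ b) spans =
  subst (λ x → D x ≡ true) (lincomb-unit v b) (spans (true ∷ replicate _ false)) VecAll.∷
  basis-⊆ D b (λ μs → subst (λ x → D x ≡ true) (lincomb-∷false μs v b) (spans (false ∷ μs)))

subcode-basis : (D : Subset7) → IsSubcode r D →
  ∃ λ b → Independent b × VecAll.All (_∈ codewords) b × D ≐ member (spanTrie b)
subcode-basis D ((b , indep , D⊆span , span⊆D) , D⊆C) = b , indep , b⊆cs , D≐span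
  where
  b⊆cs = VecAll.map (λ {v} v∈D → InC⇒∈codewords (D⊆C v v∈D)) (basis-⊆ D b span⊆D)
  D≐span : D ≐ member (spanTrie b)
  D≐span x = ⇔→≡ (mk⇔ to from)
    where
    to : D x ≡ true → member (spanTrie b) x ≡ true
    to x∈D with λs , refl ← D⊆span x x∈D = spanTrie-lincomb b λs
    from : member (spanTrie b) x ≡ true → D x ≡ true
    from x∈span with λs , refl ← spanTrie-lincomb⁻ b x x∈span = span⊆D λs

-- The census of the subcodes, checked by evaluation

ofWeight : ℕ → List (Entry r) → List (Entry r)
ofWeight w = filter (λ e → supportSize (basis e) ≟ w)

Census : (r : ℕ) → List (Entry r) → Set
Census r es =
  Linked (λ e e′ → key e < key e′) es ×
  ((w : Fin 8) → length (ofWeight (toℕ w) es) ≡ table r (toℕ w))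

census? : (r : ℕ) (es : List (Entry r)) → Dec (Census r es)
census? r es =
  linked? (λ e e′ → key e <? key e′) es ×-dec
  all? (λ w → length (ofWeight (toℕ w) es) ≟ table r (toℕ w))

Verified : (f r : ℕ) → List (Entry r) → Set
Verified zero r es = es ≡ []
Verified (suc f) r es = Census r es × Verified f (suc r) (next es)

verified? : (f r : ℕ) (es : List (Entry r)) → Dec (Verified f r es)
verified? zero r [] = yes refl
verified? zero r (_ ∷ _) = no λ ()
verified? (suc f) r es = census? r es ×-dec verified? f (suc r) (next es)

-- The one closed fact about the enumeration, established by evaluation. Everything else
-- keeps the dimension a variable: the type checker would normalise a closed type such as
-- Census 3 (subspaces 3) without sharing.
verification : does (verified? 6 1 (subspaces 1)) ≡ true
verification = refl

does⇒Verified : (f r : ℕ) → does (verified? f r (subspaces r)) ≡ true → Verified f r (subspaces r)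
does⇒Verified f r ok =
  toWitness (Equivalence.from T-≡ (trans (isYes≗does (verified? f r (subspaces r))) ok))

Verified⇒census : {f r : ℕ} → Verified f r (subspaces r) → r ≤ s → s < f + r →
  Census s (subspaces s)
Verified⇒census {f = zero} _ r≤s s<r = contradiction (<-≤-trans s<r r≤s) (<-irrefl refl)
Verified⇒census {s} {suc f} {r} (level , rest) r≤s s< with m≤n⇒m<n∨m≡n r≤s
... | inj₂ refl = level
... | inj₁ r<s = Verified⇒census {f = f} {suc r} rest r<s (subst (s <_) (sym (+-suc f r)) s<)

subspaces-stay-empty : subspaces r ≡ [] → r ≤′ s → subspaces s ≡ []
subspaces-stay-empty empty ≤′-refl = empty
subspaces-stay-empty empty (≤′-step r≤′s) = cong next (subspaces-stay-empty empty r≤′s)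

Verified⇒vanish : {f r : ℕ} → Verified f r (subspaces r) → f + r ≤ s → subspaces s ≡ []
Verified⇒vanish {f = zero} empty r≤s = subspaces-stay-empty empty (≤⇒≤′ r≤s)
Verified⇒vanish {s} {suc f} {r} (_ , rest) le =
  Verified⇒vanish {f = f} {suc r} rest (subst (_≤ s) (sym (+-suc f r)) le)

census-C₂ : 1 ≤ r → r ≤ 6 → Census r (subspaces r)
census-C₂ 1≤r r≤6 = Verified⇒census {f = 6} {1} (does⇒Verified 6 1 verification) 1≤r (s≤s r≤6)

subspaces-vanish : 7 ≤ r → subspaces r ≡ []
subspaces-vanish = Verified⇒vanish {f = 6} {1} (does⇒Verified 6 1 verification)

table-weight≥8 : (r k : ℕ) → table r (8 + k) ≡ 0
table-weight≥8 0 k = refl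
table-weight≥8 1 k = refl
table-weight≥8 2 k = refl
table-weight≥8 3 k = refl
table-weight≥8 4 k = refl
table-weight≥8 5 k = refl
table-weight≥8 6 k = refl
table-weight≥8 (suc (suc (suc (suc (suc (suc (suc r))))))) k = refl

table-dimension≥7 : (r w : ℕ) → table (7 + r) w ≡ 0
table-dimension≥7 r w = refl

ofWeight-vanishes : (k : ℕ) (es : List (Entry r)) → ofWeight (8 + k) es ≡ []
ofWeight-vanishes k es = filter-none (λ e → supportSize (basis e) ≟ 8 + k)
  (All.universal (λ e size≡ → <-irrefl size≡ (<-≤-trans (s≤s (supportSize≤ (basis e))) (m≤m+n 8 k)))
    es)

count-table-census : (r w : ℕ) → 1 ≤ r → r ≤ 6 → w < 8 →
  length (ofWeight w (subspaces r)) ≡ table r w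
count-table-census r w 1≤r r≤6 w<8 =
  subst (λ u → length (ofWeight u (subspaces r)) ≡ table r u) (toℕ-fromℕ< w<8)
    (proj₂ (census-C₂ 1≤r r≤6) (fromℕ< w<8))

count-table-weight≥8 : (r w : ℕ) → 8 ≤ w → length (ofWeight w (subspaces r)) ≡ table r w
count-table-weight≥8 r w 8≤w =
  let k , 8+k≡w = m≤n⇒∃[o]m+o≡n 8≤w
  in subst (λ u → length (ofWeight u (subspaces r)) ≡ table r u) 8+k≡w
       (trans (cong length (ofWeight-vanishes k (subspaces r))) (sym (table-weight≥8 r k)))

count-table-dimension≥7 : (r w : ℕ) → 7 ≤ r → length (ofWeight w (subspaces r)) ≡ table r w
count-table-dimension≥7 r w 7≤r =
  let k , 7+k≡r = m≤n⇒∃[o]m+o≡n 7≤r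
  in trans (cong (length ∘ ofWeight w) (subspaces-vanish 7≤r))
       (subst (λ u → 0 ≡ table u w) 7+k≡r (sym (table-dimension≥7 k w)))

count-table : (r w : ℕ) → 1 ≤ r → length (ofWeight w (subspaces r)) ≡ table r w
count-table r w 1≤r =
  [ (λ r≤6 → [ count-table-census r w 1≤r r≤6 , count-table-weight≥8 r w ]′ (<-≤-connex w 8))
  , count-table-dimension≥7 r w
  ]′ (≤-<-connex r 6)

subspaces-distinct : 1 ≤ r →
  AllPairs (λ e e′ → ¬ (member (trie e) ≐ member (trie e′))) (subspaces r)
subspaces-distinct {r} 1≤r = AllPairs-mapWith distinct (subspaces-wellFormed r) keys-increasing
  where
  keys-increasing : AllPairs (λ e e′ → key e < key e′) (subspaces r)
  keys-increasing =
    [ (λ r≤6 → Linked⇒AllPairs <-trans (proj₁ (census-C₂ 1≤r r≤6)))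
    , (λ 6<r → subst (AllPairs _) (sym (subspaces-vanish 6<r)) []) ]′ (≤-<-connex r 6)
  distinct : {e e′ : Entry r} → WellFormed e → WellFormed e′ → key e < key e′ →
    ¬ (member (trie e) ≐ member (trie e′))
  distinct {e} {e′} (_ , key≡ , _) (_ , key′≡ , _) k<k′ e≐e′ =
    <-irrefl (trans key≡ (trans (code-cong (trie e) (trie e′) e≐e′) (sym key′≡))) k<k′

ofWeight-sound : {w : ℕ} {e : Entry r} → e ∈ ofWeight w (subspaces r) →
  IsSubcode r (member (trie e)) × weight (member (trie e)) ≡ w
ofWeight-sound {r} {w} {e} e∈
  with e∈subspaces , size≡ ← ∈-filter⁻ (λ e → supportSize (basis e) ≟ w) e∈ =
  entry-subcode e wf , trans (entry-weight e wf) size≡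
  where wf = All.lookup (subspaces-wellFormed r) e∈subspaces

ofWeight-complete : (w : ℕ) (D : Subset7) → IsSubcode r D → weight D ≡ w →
  Any (D ≐_) (map (member ∘ trie) (ofWeight w (subspaces r)))
ofWeight-complete {r} w D subcode weight≡
  with b , indep , b⊆cs , D≐span ← subcode-basis D subcode
  with e , e∈ , e≈span ← find (subspaces-complete b indep b⊆cs) =
  lose (∈-map⁺ (member ∘ trie) (∈-filter⁺ (λ e → supportSize (basis e) ≟ w) e∈ size≡)) D≐e
  where
  D≐e : D ≐ member (trie e)
  D≐e x = trans (D≐span x) (sym (e≈span x))
  size≡ : supportSize (basis e) ≡ w
  size≡ = trans (sym (entry-weight e (All.lookup (subspaces-wellFormed r) e∈)))
    (trans (sym (weight-cong D (member (trie e)) D≐e)) weight≡)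

theorem4p2 : (r w : ℕ) → 1 ≤ r → SpectrumIs r w (table r w)
theorem4p2 r w 1≤r =
  map (member ∘ trie) selected ,
  trans (length-map (member ∘ trie) selected) (count-table r w 1≤r) ,
  All.map⁺ (All.tabulate ofWeight-sound) ,
  AllPairs.map⁺ (AllPairs.filter⁺ _ (subspaces-distinct 1≤r)) ,
  λ D (subcode , weight≡) → ofWeight-complete w D subcode weight≡
  where selected = ofWeight w (subspaces r)
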